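{- For every integer $k\geq 1$ there is a constant $C_k$ (depending only on $k$) such that the following holds for all integers $n\geq 1$. Suppose $\mathcal{C}$ is a $k$-cover of $T_2(n)$ such that (i) every line in $\mathcal{C}$ is a standard line, i.e., a line parallel to a side of the convex hull of $T_2(n)$; (ii) whenever $\ell_1,\ell_2\in\mathcal{C}$ are parallel lines with $|\ell_1\cap T_2(n)|\leq |\ell_2\cap T_2(n)|$, the multiplicity of $\ell_1$ in $\mathcal{C}$ is at most the multiplicity of $\ell_2$ in $\mathcal{C}$. Then $|\mathcal{C}|\geq f^*(k,2)\,n - C_k$.
   Context: For integers $n\geq 1$, $d\geq 1$, the triangular grid is $T_d(n):=\{(x_1,\dots,x_d)\in\mathbb{Z}_{\geq 0}^d : x_1+\dots+x_d\leq n-1\}$; in particular $T_2(n)=\{(x,y)\in\mathbb{Z}_{\geq 0}^2: x+y\leq n-1\}$, whose convex hull has sides parallel to the lines $x=0$, $y=0$, $x+y=0$. A $k$-cover of $T_2(n)$ is a finite multiset of lines in $\mathbb{R}^2$ such that every point of $T_2(n)$ lies in at least $k$ of its members (counted with multiplicity); $|\mathcal{C}|$ is its cardinality with multiplicity. A fractional cover of $T_d(n)$ is an assignment of nonnegative weights $w(H)$ to affine hyperplanes $H$ (finitely many nonzero) with $\sum_{H\ni p}w(H)\geq 1$ for every $p\in T_d(n)$; $f^*(n,d)$ is the minimum total weight of a fractional cover.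
   Formalization: The standard lines in $\mathcal{C}$ have rational offsets, and the fractional covers defining $f^*(k,2)$ use hyperplanes with rational coefficients and rational weights. -}

module Defs where

open import Data.Nat as ℕ using (ℕ; zero; suc; _<_)
open import Data.Integer using (+_)
open import Data.Rational as ℚ using (ℚ; 0ℚ; 1ℚ; _/_)
open import Data.Fin using (Fin) renaming (zero to fz; suc to fs)
open import Data.List using (List; []; _∷_; length; filter; concatMap; upTo; map)
open import Data.List.Membership.Propositional using (_∈_)
open import Data.Product using (Σ; _×_; _,_; proj₁; proj₂; ∃)
open import Relation.Nullary using (¬_; Dec; yes; no)
open import Relation.Binary.PropositionalEquality using (_≡_; refl; cong)
open import Relation.Binary.Definitions using (DecidableEquality)

ℕ→ℚ : ℕ → ℚ
ℕ→ℚ n = (+ n) / 1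

sumℕ : ∀ {d} → (Fin d → ℕ) → ℕ
sumℕ {zero}  f = 0
sumℕ {suc d} f = f fz ℕ.+ sumℕ (λ i → f (fs i))

sumQ : ∀ {d} → (Fin d → ℚ) → ℚ
sumQ {zero}  f = 0ℚ
sumQ {suc d} f = f fz ℚ.+ sumQ (λ i → f (fs i))

InT : (n d : ℕ) → (Fin d → ℕ) → Set
InT n d p = sumℕ p < n

record Hyp (d : ℕ) : Set where
  constructor hyp
  field
    normal : Fin d → ℚ
    offset : ℚ

NonDegenerate : ∀ {d} → Hyp d → Set
NonDegenerate H = ∃ λ i → ¬ (Hyp.normal H i ≡ 0ℚ)

_∈H?_ : ∀ {d} (p : Fin d → ℕ) (H : Hyp d) →
        Dec (sumQ (λ i → Hyp.normal H i ℚ.* ℕ→ℚ (p i)) ≡ Hyp.offset H)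
p ∈H? H = sumQ (λ i → Hyp.normal H i ℚ.* ℕ→ℚ (p i)) ℚ.≟ Hyp.offset H

WFamily : ℕ → Set
WFamily d = List (Hyp d × ℚ)

totalWeight : ∀ {d} → WFamily d → ℚ
totalWeight []            = 0ℚ
totalWeight ((H , w) ∷ W) = w ℚ.+ totalWeight W

weightAt : ∀ {d} → (Fin d → ℕ) → WFamily d → ℚ
weightAt p [] = 0ℚ
weightAt p ((H , w) ∷ W) with p ∈H? H
... | yes _ = w ℚ.+ weightAt p W
... | no  _ = weightAt p W

IsFractionalCover : (n d : ℕ) → WFamily d → Set
IsFractionalCover n d W =
  (∀ {H w} → (H , w) ∈ W → NonDegenerate H × 0ℚ ℚ.≤ w) ×
  (∀ (p : Fin d → ℕ) → InT n d p → 1ℚ ℚ.≤ weightAt p W)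

IsFStar : (n d : ℕ) → ℚ → Set
IsFStar n d f =
  (Σ (WFamily d) λ W → IsFractionalCover n d W × totalWeight W ≡ f) ×
  (∀ (W : WFamily d) → IsFractionalCover n d W → f ℚ.≤ totalWeight W)

-- directions of the sides of conv T_2(n): x = c, y = c, x + y = c
data Dir : Set where
  xConst yConst sumConst : Dir

_≟D_ : DecidableEquality Dir
xConst   ≟D xConst   = yes refl
xConst   ≟D yConst   = no λ ()
xConst   ≟D sumConst = no λ ()
yConst   ≟D xConst   = no λ ()
yConst   ≟D yConst   = yes refl
yConst   ≟D sumConst = no λ ()
sumConst ≟D xConst   = no λ ()
sumConst ≟D yConst   = no λ ()
sumConst ≟D sumConst = yes refl

record StdLine : Set where
  constructor stdLine
  field
    dir   : Dir
    level : ℚ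

_≟L_ : DecidableEquality StdLine
stdLine d c ≟L stdLine d' c' with d ≟D d' | c ℚ.≟ c'
... | yes refl | yes refl = yes refl
... | no ne    | _        = no λ { refl → ne refl }
... | yes _    | no ne    = no λ { refl → ne refl }

form : Dir → ℕ → ℕ → ℚ
form xConst   x y = ℕ→ℚ x
form yConst   x y = ℕ→ℚ y
form sumConst x y = ℕ→ℚ x ℚ.+ ℕ→ℚ y

_∈L?_ : (p : ℕ × ℕ) (ℓ : StdLine) →
        Dec (form (StdLine.dir ℓ) (proj₁ p) (proj₂ p) ≡ StdLine.level ℓ)
(x , y) ∈L? ℓ = form (StdLine.dir ℓ) x y ℚ.≟ StdLine.level ℓ

T2 : ℕ → List (ℕ × ℕ)
T2 n = concatMap (λ x → map (λ y → (x , y)) (upTo (n ℕ.∸ x))) (upTo n)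

sizeOn : ℕ → StdLine → ℕ
sizeOn n ℓ = length (filter (_∈L? ℓ) (T2 n))

mult : StdLine → List StdLine → ℕ
mult ℓ C = length (filter (_≟L ℓ) C)

coverCount : ℕ × ℕ → List StdLine → ℕ
coverCount p C = length (filter (p ∈L?_) C)

IsKCover : (k n : ℕ) → List StdLine → Set
IsKCover k n C = ∀ x y → x ℕ.+ y < n → k ℕ.≤ coverCount (x , y) C

MultMonotone : ℕ → List StdLine → Set
MultMonotone n C =
  ∀ ℓ₁ ℓ₂ → ℓ₁ ∈ C → ℓ₂ ∈ C → StdLine.dir ℓ₁ ≡ StdLine.dir ℓ₂ →
  sizeOn n ℓ₁ ℕ.≤ sizeOn n ℓ₂ → mult ℓ₁ C ℕ.≤ mult ℓ₂ C

{-# OPTIONS --safe #-}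
-- Let a_i, b_i, c_i be the multiplicities
-- in C of the lines x = i, y = i, x + y = i. Giving weight 1/n to each hyperplane x = t
-- (t < a_i), y = t (t < b_i) and x + y = k - 1 - t (t < c_i), for all i < n, yields a
-- fractional cover of T_2(k) of total weight at most |C|/n, whence f*(k,2) n ≤ |C|.
-- It covers a point (u, v) of T_2(k), with w = k - 1 - u - v: as a_x + b_y + c_{x+y} ≥ k
-- = u + v + w + 1 on T_2(n), every point of T_2(n) has a_x > u, b_y > v or c_{x+y} > w.
-- If m is least with a_m ≤ u (or m = n), then a_i > u for i < m, and each point (m, y),
-- y < n - m, gives b_y > v or c_{m+y} > w: n distinct exceedances, each of weight 1/n.
module Submission where

open import Defs
open import Data.Nat using (ℕ; _≤_)
open import Data.Rational using (ℚ; _*_; _-_) renaming (_≤_ to _≤ℚ_)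
open import Data.List using (List; length)
open import Data.Product using (Σ)

open import Function using (_∘_)
open import Data.Bool using (true; false)
open import Data.Sum using (_⊎_; inj₁; inj₂)
open import Data.Product using (_,_; _×_)
open import Data.Fin using (Fin) renaming (zero to fz; suc to fs)
open import Data.Nat as ℕ using (zero; suc; _+_; _∸_; _<_; _<?_; z≤n; s≤s; z<s; s<s)
open import Data.Nat.Properties
  using ( ≤-refl; ≤-trans; ≤-reflexive; +-mono-≤; +-monoʳ-≤; m≤m+n; m≤n+m; +-identityʳ; +-assoc
        ; ≮⇒≥; ≤⇒≯; suc-injective; 0≢1+n; m+[n∸m]≡n; m∸[m∸n]≡n; +-commutativeSemigroup
        ; module ≤-Reasoning )
open import Algebra.Properties.CommutativeSemigroup +-commutativeSemigroup using (interchange)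
import Data.Integer as ℤ
import Data.Integer.Properties as ℤP
open import Data.Rational as ℚ using (mkℚ; 0ℚ; 1ℚ; 1/_)
import Data.Rational.Properties as ℚP
open import Algebra.Definitions.RawMonoid ℚ.+-0-rawMonoid using () renaming (_×_ to _×ℚ_)
import Data.Nat.Coprimality as Coprimality
open import Data.List using ([]; _∷_; _++_; map; filter; concat; applyUpTo)
open import Data.List.Properties using (length-++; length-applyUpTo; filter-++; filter-some)
open import Data.List.Membership.Propositional using (_∈_; lose)
open import Data.List.Membership.Propositional.Properties using (∈-map⁻; ∈-applyUpTo⁺)
open import Data.List.Relation.Unary.All as All using (All)
open import Data.List.Relation.Unary.All.Properties using (++⁺; concat⁺; applyUpTo⁺₂)
open import Relation.Nullary using (Dec; _because_; yes; no; ¬_; contradiction)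
open import Relation.Unary using (Decidable)
open import Relation.Binary.PropositionalEquality
  using (_≡_; refl; sym; trans; cong; cong₂; subst; subst₂; module ≡-Reasoning)

⟦_⟧ : ∀ {p} {P : Set p} → Dec P → ℕ
⟦ true  because _ ⟧ = 1
⟦ false because _ ⟧ = 0

1≤⟦⟧ : ∀ {p} {P : Set p} (P? : Dec P) → P → 1 ≤ ⟦ P? ⟧
1≤⟦⟧ (yes _) _  = ≤-refl
1≤⟦⟧ (no ¬p) p = contradiction p ¬p

⟦⟧-false : ∀ {p} {P : Set p} (P? : Dec P) → ¬ P → ⟦ P? ⟧ ≡ 0
⟦⟧-false (yes p) ¬p = contradiction p ¬p
⟦⟧-false (no _)  _  = refl

∑< : ℕ → (ℕ → ℕ) → ℕ
∑< zero    f = 0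
∑< (suc n) f = f 0 + ∑< n (f ∘ suc)

∑<-cong : ∀ n {f g : ℕ → ℕ} → (∀ i → f i ≡ g i) → ∑< n f ≡ ∑< n g
∑<-cong zero    _   = refl
∑<-cong (suc n) f≡g = cong₂ _+_ (f≡g 0) (∑<-cong n (f≡g ∘ suc))

∑<-zero : ∀ n {f : ℕ → ℕ} → (∀ i → f i ≡ 0) → ∑< n f ≡ 0
∑<-zero zero    _  = refl
∑<-zero (suc n) f≡0 = cong₂ _+_ (f≡0 0) (∑<-zero n (f≡0 ∘ suc))

∑<-distrib-+ : ∀ n (f g : ℕ → ℕ) → ∑< n (λ i → f i + g i) ≡ ∑< n f + ∑< n g
∑<-distrib-+ zero    f g = refl
∑<-distrib-+ (suc n) f g =
  trans (cong ((f 0 + g 0) +_) (∑<-distrib-+ n (f ∘ suc) (g ∘ suc))) (interchange (f 0) (g 0) _ _)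

∑<-mono-≤ : ∀ n {f g : ℕ → ℕ} → (∀ i → f i ≤ g i) → ∑< n f ≤ ∑< n g
∑<-mono-≤ zero    _   = z≤n
∑<-mono-≤ (suc n) f≤g = +-mono-≤ (f≤g 0) (∑<-mono-≤ n (f≤g ∘ suc))

∑<-≤-suc : ∀ n (f : ℕ → ℕ) → ∑< n f ≤ ∑< (suc n) f
∑<-≤-suc zero    f = z≤n
∑<-≤-suc (suc n) f = +-monoʳ-≤ (f 0) (∑<-≤-suc n (f ∘ suc))

n≤∑< : ∀ n {f : ℕ → ℕ} → (∀ i → i < n → 1 ≤ f i) → n ≤ ∑< n f
n≤∑< zero    _   = z≤n
n≤∑< (suc n) 1≤f = +-mono-≤ (1≤f 0 z<s) (n≤∑< n (λ i i<n → 1≤f (suc i) (s<s i<n)))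

∑<-⟦⟧≤1 : ∀ {p} {P : ℕ → Set p} (P? : Decidable P) n →
          (∀ {i j} → P i → P j → i ≡ j) → ∑< n (λ i → ⟦ P? i ⟧) ≤ 1
∑<-⟦⟧≤1 P? zero    _      = z≤n
∑<-⟦⟧≤1 P? (suc n) unique with P? 0
... | yes P0 = ≤-reflexive (cong suc (∑<-zero n (λ i → ⟦⟧-false (P? (suc i)) (0≢1+n ∘ unique P0))))
... | no  _  = ∑<-⟦⟧≤1 (P? ∘ suc) n (λ Pi Pj → suc-injective (unique Pi Pj))

#exceeding : ℕ → (ℕ → ℕ) → ℕ → ℕ
#exceeding t f n = ∑< n (λ i → ⟦ t <? f i ⟧)

exceeds-one-of : ∀ {u v w p q r} → suc (u + v + w) ≤ p + q + r → u < p ⊎ v < q ⊎ w < r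
exceeds-one-of {u} {v} {w} {p} {q} {r} k≤ with u <? p | v <? q | w <? r
... | yes u<p | _       | _       = inj₁ u<p
... | no _    | yes v<q | _       = inj₂ (inj₁ v<q)
... | no _    | no _    | yes w<r = inj₂ (inj₂ w<r)
... | no u≮p  | no v≮q  | no w≮r  =
  contradiction k≤ (≤⇒≯ (+-mono-≤ (+-mono-≤ (≮⇒≥ u≮p) (≮⇒≥ v≮q)) (≮⇒≥ w≮r)))

staircase : ∀ {u v w} n (a b c : ℕ → ℕ) →
            (∀ x y → x + y < n → u < a x ⊎ v < b y ⊎ w < c (x + y)) →
            n ≤ #exceeding u a n + #exceeding v b n + #exceeding w c n
staircase zero a b c _ = z≤n
-- If a 0 > u, the column x = 0 gives one exceedance and is deleted, which shifts a and c
-- but not b; otherwise the points (0 , y) give the bound.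
staircase {u} {v} {w} (suc n) a b c cover with u <? a 0
... | yes _ = s≤s (begin
    n                                  ≤⟨ staircase n (a ∘ suc) b (c ∘ suc) (λ x y → cover (suc x) y ∘ s<s) ⟩
    A + #exceeding v b n + C           ≤⟨ +-mono-≤ (+-monoʳ-≤ A (∑<-≤-suc n _)) (m≤n+m C _) ⟩
    A + #exceeding v b (suc n) + (⟦ w <? c 0 ⟧ + C) ∎)
  where
  open ≤-Reasoning
  A = #exceeding u (a ∘ suc) n
  C = #exceeding w (c ∘ suc) n
... | no u≮a₀ = begin
    suc n
      ≤⟨ n≤∑< (suc n) one-of ⟩
    ∑< (suc n) (λ i → ⟦ v <? b i ⟧ + ⟦ w <? c i ⟧)
      ≡⟨ ∑<-distrib-+ (suc n) (λ i → ⟦ v <? b i ⟧) (λ i → ⟦ w <? c i ⟧) ⟩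
    #exceeding v b (suc n) + #exceeding w c (suc n)
      ≤⟨ m≤n+m _ A ⟩
    A + (#exceeding v b (suc n) + #exceeding w c (suc n))
      ≡⟨ +-assoc A _ _ ⟨
    A + #exceeding v b (suc n) + #exceeding w c (suc n) ∎
  where
  open ≤-Reasoning
  A = #exceeding u (a ∘ suc) n
  one-of : ∀ y → y < suc n → 1 ≤ ⟦ v <? b y ⟧ + ⟦ w <? c y ⟧
  one-of y y<n with cover 0 y y<n
  ... | inj₁ u<a₀         = contradiction u<a₀ u≮a₀
  ... | inj₂ (inj₁ v<b)   = ≤-trans (1≤⟦⟧ (v <? b y) v<b) (m≤m+n _ _)
  ... | inj₂ (inj₂ w<c)   = ≤-trans (1≤⟦⟧ (w <? c y) w<c) (m≤n+m _ _)

ℕ→ℚ≡mkℚ : ∀ n → ℕ→ℚ n ≡ mkℚ (ℤ.+ n) 0 (Coprimality.sym (Coprimality.1-coprimeTo n))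
ℕ→ℚ≡mkℚ n = ℚP.normalize-coprime (Coprimality.sym (Coprimality.1-coprimeTo n))

ℕ→ℚ-injective : ∀ {m n} → ℕ→ℚ m ≡ ℕ→ℚ n → m ≡ n
ℕ→ℚ-injective {m} {n} eq with trans (sym (ℕ→ℚ≡mkℚ m)) (trans eq (ℕ→ℚ≡mkℚ n))
... | refl = refl

ℕ→ℚ-+ : ∀ m n → ℕ→ℚ (m + n) ≡ ℕ→ℚ m ℚ.+ ℕ→ℚ n
ℕ→ℚ-+ m n rewrite ℕ→ℚ≡mkℚ m | ℕ→ℚ≡mkℚ n =
  cong (ℚ._/ 1) (sym (cong₂ ℤ._+_ (ℤP.*-identityʳ (ℤ.+ m)) (ℤP.*-identityʳ (ℤ.+ n))))

ℕ→ℚ-mono-≤ : ∀ {m n} → m ≤ n → ℕ→ℚ m ≤ℚ ℕ→ℚ n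
ℕ→ℚ-mono-≤ {m} {n} m≤n rewrite ℕ→ℚ≡mkℚ m | ℕ→ℚ≡mkℚ n =
  ℚ.*≤* (subst₂ ℤ._≤_ (sym (ℤP.*-identityʳ (ℤ.+ m))) (sym (ℤP.*-identityʳ (ℤ.+ n))) (ℤ.+≤+ m≤n))

×ℚ≡ℕ→ℚ* : ∀ m w → m ×ℚ w ≡ ℕ→ℚ m * w
×ℚ≡ℕ→ℚ* zero    w = sym (ℚP.*-zeroˡ w)
×ℚ≡ℕ→ℚ* (suc m) w = begin
  w ℚ.+ m ×ℚ w               ≡⟨ cong (w ℚ.+_) (×ℚ≡ℕ→ℚ* m w) ⟩
  w ℚ.+ ℕ→ℚ m * w            ≡⟨ cong (ℚ._+ ℕ→ℚ m * w) (ℚP.*-identityˡ w) ⟨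
  1ℚ * w ℚ.+ ℕ→ℚ m * w       ≡⟨ ℚP.*-distribʳ-+ w 1ℚ (ℕ→ℚ m) ⟨
  (1ℚ ℚ.+ ℕ→ℚ m) * w         ≡⟨ cong (_* w) (ℕ→ℚ-+ 1 m) ⟨
  ℕ→ℚ (suc m) * w            ∎
  where open ≡-Reasoning

module _ (r : ℚ) .{{r>0 : ℚ.Positive r}} where

  private instance
    r≢0 : ℚ.NonZero r
    r≢0 = ℚP.pos⇒nonZero r

    r≥0 : ℚ.NonNegative r
    r≥0 = ℚP.pos⇒nonNeg r

    1/r≥0 : ℚ.NonNegative (1/ r)
    1/r≥0 = ℚP.pos⇒nonNeg (1/ r) {{ℚP.1/pos⇒pos r}}

  1/-nonNeg : 0ℚ ≤ℚ 1/ r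
  1/-nonNeg = ℚP.nonNegative⁻¹ (1/ r)

  ≥⇒1≤*1/ : ∀ {q} → r ≤ℚ q → 1ℚ ≤ℚ q * 1/ r
  ≥⇒1≤*1/ {q} r≤q = subst (_≤ℚ q * 1/ r) (ℚP.*-inverseʳ r) (ℚP.*-monoʳ-≤-nonNeg (1/ r) r≤q)

  ≤*1/⇒*≤ : ∀ {p q} → p ≤ℚ q * 1/ r → p * r ≤ℚ q
  ≤*1/⇒*≤ {p} {q} p≤q/r = begin
    p * r            ≤⟨ ℚP.*-monoʳ-≤-nonNeg r p≤q/r ⟩
    q * 1/ r * r     ≡⟨ ℚP.*-assoc q (1/ r) r ⟩
    q * (1/ r * r)   ≡⟨ cong (q *_) (ℚP.*-inverseˡ r) ⟩
    q * 1ℚ           ≡⟨ ℚP.*-identityʳ q ⟩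
    q                ∎
    where open ℚP.≤-Reasoning

-- Declared only now: while in scope, these instances make every search for ℚ.NonZero r
-- try to unfold ℕ→ℚ against r.
instance
  ℕ→ℚ-positive : ∀ {n} .{{_ : ℕ.NonZero n}} → ℚ.Positive (ℕ→ℚ n)
  ℕ→ℚ-positive {n} = ℚP.normalize-pos n 1

  ℕ→ℚ-nonZero : ∀ {n} .{{_ : ℕ.NonZero n}} → ℚ.NonZero (ℕ→ℚ n)
  ℕ→ℚ-nonZero {n} = ℚP.pos⇒nonZero (ℕ→ℚ n)

coord : Dir → ℕ → ℕ → ℕ
coord xConst   x y = x
coord yConst   x y = y
coord sumConst x y = x + y

form≡coord : ∀ d x y → form d x y ≡ ℕ→ℚ (coord d x y)
form≡coord xConst   x y = refl
form≡coord yConst   x y = refl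
form≡coord sumConst x y = sym (ℕ→ℚ-+ x y)

_∈H_ : ∀ {d} → (Fin d → ℕ) → Hyp d → Set
p ∈H H = sumQ (λ i → Hyp.normal H i * ℕ→ℚ (p i)) ≡ Hyp.offset H

normal : Dir → Fin 2 → ℚ
normal xConst   fz     = 1ℚ
normal xConst   (fs _) = 0ℚ
normal yConst   fz     = 0ℚ
normal yConst   (fs _) = 1ℚ
normal sumConst _      = 1ℚ

stdHyp : Dir → ℕ → Hyp 2
stdHyp d t = hyp (normal d) (ℕ→ℚ t)

stdHyp-nonDegenerate : ∀ d t → NonDegenerate (stdHyp d t)
stdHyp-nonDegenerate xConst   t = fz , λ ()
stdHyp-nonDegenerate yConst   t = fs fz , λ ()
stdHyp-nonDegenerate sumConst t = fz , λ ()

normal·≡form : ∀ d (p : Fin 2 → ℕ) →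
               sumQ (λ i → normal d i * ℕ→ℚ (p i)) ≡ form d (p fz) (p (fs fz))
normal·≡form d p = trans (cong (normal d fz * X ℚ.+_) (ℚP.+-identityʳ (normal d (fs fz) * Y))) (pairing d)
  where
  X = ℕ→ℚ (p fz)
  Y = ℕ→ℚ (p (fs fz))
  pairing : ∀ d → normal d fz * X ℚ.+ normal d (fs fz) * Y ≡ form d (p fz) (p (fs fz))
  pairing xConst   = trans (cong₂ ℚ._+_ (ℚP.*-identityˡ X) (ℚP.*-zeroˡ Y)) (ℚP.+-identityʳ X)
  pairing yConst   = trans (cong₂ ℚ._+_ (ℚP.*-zeroˡ X) (ℚP.*-identityˡ Y)) (ℚP.+-identityˡ Y)
  pairing sumConst = cong₂ ℚ._+_ (ℚP.*-identityˡ X) (ℚP.*-identityˡ Y)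

∈stdHyp-coord : ∀ d (p : Fin 2 → ℕ) → p ∈H stdHyp d (coord d (p fz) (p (fs fz)))
∈stdHyp-coord d p = trans (normal·≡form d p) (form≡coord d (p fz) (p (fs fz)))

hits : ∀ {d} → (Fin d → ℕ) → List (Hyp d) → ℕ
hits p hs = length (filter (p ∈H?_) hs)

hits-++ : ∀ {d} (p : Fin d → ℕ) xs ys → hits p (xs ++ ys) ≡ hits p xs + hits p ys
hits-++ p xs ys = trans (cong length (filter-++ (p ∈H?_) xs ys)) (length-++ (filter (p ∈H?_) xs))

⟦<?⟧≤hits-applyUpTo : ∀ {d} (p : Fin d → ℕ) (h : ℕ → Hyp d) {t} m → p ∈H h t →
                      ⟦ t <? m ⟧ ≤ hits p (applyUpTo h m)
⟦<?⟧≤hits-applyUpTo p h {t} m p∈ht with t <? m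
... | yes t<m = filter-some (p ∈H?_) (lose (∈-applyUpTo⁺ h t<m) p∈ht)
... | no  _   = z≤n

uniform : ∀ {d} → ℚ → List (Hyp d) → WFamily d
uniform w = map (_, w)

-- Stated with _×ℚ_ rather than ℕ→ℚ m * w because `with` normalises the goal, and normal
-- forms of ℕ→ℚ m are huge.
totalWeight-uniform : ∀ {d} w (hs : List (Hyp d)) → totalWeight (uniform w hs) ≡ length hs ×ℚ w
totalWeight-uniform w []       = refl
totalWeight-uniform w (_ ∷ hs) = cong (w ℚ.+_) (totalWeight-uniform w hs)

weightAt-uniform : ∀ {d} (p : Fin d → ℕ) w hs → weightAt p (uniform w hs) ≡ hits p hs ×ℚ w
weightAt-uniform p w []       = refl
weightAt-uniform p w (H ∷ hs) with p ∈H? H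
... | yes _ = cong (w ℚ.+_) (weightAt-uniform p w hs)
... | no  _ = weightAt-uniform p w hs

uniform-isFractionalCover : ∀ {n d w} {hs : List (Hyp d)} → 0ℚ ≤ℚ w → All NonDegenerate hs →
                            (∀ p → InT n d p → 1ℚ ≤ℚ hits p hs ×ℚ w) →
                            IsFractionalCover n d (uniform w hs)
uniform-isFractionalCover {n} {d} {w} {hs} w≥0 nonDegenerate covered = member , point
  where
  member : ∀ {H w′} → (H , w′) ∈ uniform w hs → NonDegenerate H × 0ℚ ≤ℚ w′
  member H,w′∈ with ∈-map⁻ (_, w) H,w′∈
  ... | _ , H∈hs , refl = All.lookup nonDegenerate H∈hs , w≥0
  point : ∀ p → InT n d p → 1ℚ ≤ℚ weightAt p (uniform w hs)
  point p p∈T = subst (1ℚ ≤ℚ_) (sym (weightAt-uniform p w hs)) (covered p p∈T)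

∑<-concat : ∀ {a} {A : Set a} (h : List A → ℕ) → h [] ≡ 0 → (∀ xs ys → h (xs ++ ys) ≡ h xs + h ys) →
            ∀ n (F : ℕ → List A) → h (concat (applyUpTo F n)) ≡ ∑< n (h ∘ F)
∑<-concat h h[] h++ zero    F = h[]
∑<-concat h h[] h++ (suc n) F =
  trans (h++ (F 0) _) (cong (h (F 0) +_) (∑<-concat h h[] h++ n (F ∘ suc)))

k∸suc-involutive : ∀ {s k} → s < k → k ∸ suc (k ∸ suc s) ≡ s
k∸suc-involutive (s≤s s≤k-1) = m∸[m∸n]≡n s≤k-1

module Profile (k : ℕ) (a b c : ℕ → ℕ) where

  xHyps yHyps sumHyps : ℕ → List (Hyp 2)
  xHyps   i = applyUpTo (stdHyp xConst) (a i)
  yHyps   i = applyUpTo (stdHyp yConst) (b i)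
  sumHyps i = applyUpTo (stdHyp sumConst ∘ (k ∸_) ∘ suc) (c i)

  hyps : ℕ → List (Hyp 2)
  hyps n = concat (applyUpTo (λ i → (xHyps i ++ yHyps i) ++ sumHyps i) n)

  additive-hyps : (h : List (Hyp 2) → ℕ) → h [] ≡ 0 → (∀ xs ys → h (xs ++ ys) ≡ h xs + h ys) →
                  ∀ n → h (hyps n) ≡ ∑< n (λ i → h (xHyps i) + h (yHyps i) + h (sumHyps i))
  additive-hyps h h[] h++ n = trans (∑<-concat h h[] h++ n _) (∑<-cong n λ i →
    trans (h++ (xHyps i ++ yHyps i) (sumHyps i)) (cong (_+ h (sumHyps i)) (h++ (xHyps i) (yHyps i))))

  length-hyps : ∀ n → length (hyps n) ≡ ∑< n (λ i → a i + b i + c i)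
  length-hyps n = trans (additive-hyps length refl (λ xs _ → length-++ xs) n) (∑<-cong n λ i →
    cong₂ _+_ (cong₂ _+_ (length-applyUpTo _ (a i)) (length-applyUpTo _ (b i))) (length-applyUpTo _ (c i)))

  hyps-nonDegenerate : ∀ n → All NonDegenerate (hyps n)
  hyps-nonDegenerate n = concat⁺ (applyUpTo⁺₂ _ n λ i →
    ++⁺ (++⁺ (applyUpTo⁺₂ _ (a i) (stdHyp-nonDegenerate xConst))
             (applyUpTo⁺₂ _ (b i) (stdHyp-nonDegenerate yConst)))
        (applyUpTo⁺₂ _ (c i) (stdHyp-nonDegenerate sumConst ∘ (k ∸_) ∘ suc)))

  module _ (p : Fin 2 → ℕ) (u+v<k : p fz + p (fs fz) < k) where

    private
      u v w : ℕ
      u = p fz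
      v = p (fs fz)
      w = k ∸ suc (u + v)

    #exceeding≤hits : ∀ n → #exceeding u a n + #exceeding v b n + #exceeding w c n ≤ hits p (hyps n)
    #exceeding≤hits n = begin
      #exceeding u a n + #exceeding v b n + #exceeding w c n
        ≡⟨ cong (_+ #exceeding w c n) (∑<-distrib-+ n (λ i → ⟦ u <? a i ⟧) (λ i → ⟦ v <? b i ⟧)) ⟨
      ∑< n (λ i → ⟦ u <? a i ⟧ + ⟦ v <? b i ⟧) + #exceeding w c n
        ≡⟨ ∑<-distrib-+ n (λ i → ⟦ u <? a i ⟧ + ⟦ v <? b i ⟧) (λ i → ⟦ w <? c i ⟧) ⟨
      ∑< n (λ i → ⟦ u <? a i ⟧ + ⟦ v <? b i ⟧ + ⟦ w <? c i ⟧)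
        ≤⟨ ∑<-mono-≤ n (λ i → +-mono-≤ (+-mono-≤ (⟦<?⟧≤hits-applyUpTo p _ (a i) (∈stdHyp-coord xConst p))
                                                 (⟦<?⟧≤hits-applyUpTo p _ (b i) (∈stdHyp-coord yConst p)))
                                       (⟦<?⟧≤hits-applyUpTo p _ (c i) p∈sumHyp)) ⟩
      ∑< n (λ i → hits p (xHyps i) + hits p (yHyps i) + hits p (sumHyps i))
        ≡⟨ additive-hyps (hits p) refl (hits-++ p) n ⟨
      hits p (hyps n) ∎
      where
      open ≤-Reasoning
      p∈sumHyp : p ∈H stdHyp sumConst (k ∸ suc w)
      p∈sumHyp = subst (λ t → p ∈H stdHyp sumConst t) (sym (k∸suc-involutive u+v<k))
                       (∈stdHyp-coord sumConst p)

    n≤hits-hyps : ∀ n → (∀ x y → x + y < n → k ≤ a x + b y + c (x + y)) → n ≤ hits p (hyps n)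
    n≤hits-hyps n covers = ≤-trans (staircase n a b c exceeds) (#exceeding≤hits n)
      where
      k≡ : suc (u + v + w) ≡ k
      k≡ = m+[n∸m]≡n u+v<k
      exceeds : ∀ x y → x + y < n → u < a x ⊎ v < b y ⊎ w < c (x + y)
      exceeds x y x+y<n = exceeds-one-of (subst (_≤ _) (sym k≡) (covers x y x+y<n))

  profile-isFractionalCover : ∀ n .{{_ : ℕ.NonZero n}} → (∀ x y → x + y < n → k ≤ a x + b y + c (x + y)) →
                              IsFractionalCover k 2 (uniform (1/ ℕ→ℚ n) (hyps n))
  profile-isFractionalCover n covers =
    uniform-isFractionalCover (1/-nonNeg (ℕ→ℚ n)) (hyps-nonDegenerate n) covered
    where
    covered : ∀ p → InT k 2 p → 1ℚ ≤ℚ hits p (hyps n) ×ℚ 1/ ℕ→ℚ n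
    covered p p∈T = subst (1ℚ ≤ℚ_) (sym (×ℚ≡ℕ→ℚ* (hits p (hyps n)) (1/ ℕ→ℚ n)))
      (≥⇒1≤*1/ (ℕ→ℚ n) (ℕ→ℚ-mono-≤ (n≤hits-hyps p u+v<k n covers)))
      where
      u+v<k : p fz + p (fs fz) < k
      u+v<k = subst (_< k) (cong (p fz +_) (+-identityʳ (p (fs fz)))) p∈T

line : Dir → ℕ → StdLine
line d i = stdLine d (ℕ→ℚ i)

multiplicity : List StdLine → Dir → ℕ → ℕ
multiplicity C d i = mult (line d i) C

∑Dir : (Dir → ℕ) → ℕ
∑Dir g = g xConst + g yConst + g sumConst

∑Dir-cong : ∀ {f g : Dir → ℕ} → (∀ d → f d ≡ g d) → ∑Dir f ≡ ∑Dir g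
∑Dir-cong f≡g = cong₂ _+_ (cong₂ _+_ (f≡g xConst) (f≡g yConst)) (f≡g sumConst)

∑Dir-distrib-+ : ∀ (f g : Dir → ℕ) → ∑Dir (λ d → f d + g d) ≡ ∑Dir f + ∑Dir g
∑Dir-distrib-+ f g =
  trans (cong (_+ (f sumConst + g sumConst)) (interchange (f xConst) (g xConst) (f yConst) (g yConst)))
        (interchange (f xConst + f yConst) (g xConst + g yConst) (f sumConst) (g sumConst))

≤∑Dir : ∀ (g : Dir → ℕ) d → g d ≤ ∑Dir g
≤∑Dir g xConst   = ≤-trans (m≤m+n (g xConst) (g yConst)) (m≤m+n _ (g sumConst))
≤∑Dir g yConst   = ≤-trans (m≤n+m (g yConst) (g xConst)) (m≤m+n _ (g sumConst))
≤∑Dir g sumConst = m≤n+m (g sumConst) (g xConst + g yConst)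

length-filter-∷ : ∀ {a p} {A : Set a} {P : A → Set p} (P? : Decidable P) x xs →
                  length (filter P? (x ∷ xs)) ≡ ⟦ P? x ⟧ + length (filter P? xs)
length-filter-∷ P? x xs with P? x
... | true  because _ = refl
... | false because _ = refl

∑Dir-multiplicity-∷ : ∀ ℓ C (i : Dir → ℕ) →
  ∑Dir (λ d → multiplicity (ℓ ∷ C) d (i d))
    ≡ ∑Dir (λ d → ⟦ ℓ ≟L line d (i d) ⟧) + ∑Dir (λ d → multiplicity C d (i d))
∑Dir-multiplicity-∷ ℓ C i =
  trans (∑Dir-cong (λ d → length-filter-∷ (_≟L line d (i d)) ℓ C))
        (∑Dir-distrib-+ (λ d → ⟦ ℓ ≟L line d (i d) ⟧) (λ d → multiplicity C d (i d)))

⟦⟧≤∑Dir : ∀ {p q} {P : Set p} {Q : Dir → Set q} (P? : Dec P) (Q? : ∀ d → Dec (Q d)) d →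
          (P → Q d) → ⟦ P? ⟧ ≤ ∑Dir (λ d → ⟦ Q? d ⟧)
⟦⟧≤∑Dir (no _)  Q? d P⇒Q = z≤n
⟦⟧≤∑Dir (yes P) Q? d P⇒Q = ≤-trans (1≤⟦⟧ (Q? d) (P⇒Q P)) (≤∑Dir (λ d → ⟦ Q? d ⟧) d)

⟦∈L⟧≤∑Dir : ∀ x y ℓ → ⟦ (x , y) ∈L? ℓ ⟧ ≤ ∑Dir (λ d → ⟦ ℓ ≟L line d (coord d x y) ⟧)
⟦∈L⟧≤∑Dir x y (stdLine d q) =
  ⟦⟧≤∑Dir ((x , y) ∈L? stdLine d q) (λ d′ → stdLine d q ≟L line d′ (coord d′ x y)) d
    λ form≡q → cong (stdLine d) (trans (sym form≡q) (form≡coord d x y))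

coverCount≤∑Dir-multiplicity : ∀ x y C → coverCount (x , y) C ≤ ∑Dir (λ d → multiplicity C d (coord d x y))
coverCount≤∑Dir-multiplicity x y []      = z≤n
coverCount≤∑Dir-multiplicity x y (ℓ ∷ C) = begin
  coverCount (x , y) (ℓ ∷ C)
    ≡⟨ length-filter-∷ ((x , y) ∈L?_) ℓ C ⟩
  ⟦ (x , y) ∈L? ℓ ⟧ + coverCount (x , y) C
    ≤⟨ +-mono-≤ (⟦∈L⟧≤∑Dir x y ℓ) (coverCount≤∑Dir-multiplicity x y C) ⟩
  ∑Dir (λ d → ⟦ ℓ ≟L line d (coord d x y) ⟧) + ∑Dir (λ d → multiplicity C d (coord d x y))
    ≡⟨ ∑Dir-multiplicity-∷ ℓ C (λ d → coord d x y) ⟨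
  ∑Dir (λ d → multiplicity (ℓ ∷ C) d (coord d x y)) ∎
  where open ≤-Reasoning

-- The terms of the other two directions compute to 0, as _≟L_ compares directions first.
∑Dir-⟦≟line⟧ : ∀ ℓ i → ∑Dir (λ d → ⟦ ℓ ≟L line d i ⟧) ≡ ⟦ ℓ ≟L line (StdLine.dir ℓ) i ⟧
∑Dir-⟦≟line⟧ (stdLine xConst   q) i = trans (+-identityʳ _) (+-identityʳ _)
∑Dir-⟦≟line⟧ (stdLine yConst   q) i = +-identityʳ _
∑Dir-⟦≟line⟧ (stdLine sumConst q) i = refl

∑<-∑Dir-⟦≟line⟧≤1 : ∀ ℓ n → ∑< n (λ i → ∑Dir (λ d → ⟦ ℓ ≟L line d i ⟧)) ≤ 1
∑<-∑Dir-⟦≟line⟧≤1 ℓ n = ≤-trans (≤-reflexive (∑<-cong n (∑Dir-⟦≟line⟧ ℓ)))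
  (∑<-⟦⟧≤1 (λ i → ℓ ≟L line (StdLine.dir ℓ) i) n
    (λ ℓ≡i ℓ≡j → ℕ→ℚ-injective (cong StdLine.level (trans (sym ℓ≡i) ℓ≡j))))

∑<-multiplicity≤length : ∀ n C → ∑< n (λ i → ∑Dir (λ d → multiplicity C d i)) ≤ length C
∑<-multiplicity≤length n []      = ≤-reflexive (∑<-zero n (λ _ → refl))
∑<-multiplicity≤length n (ℓ ∷ C) = begin
  ∑< n (λ i → ∑Dir (λ d → multiplicity (ℓ ∷ C) d i))
    ≡⟨ ∑<-cong n (λ i → ∑Dir-multiplicity-∷ ℓ C (λ _ → i)) ⟩
  ∑< n (λ i → ∑Dir (λ d → ⟦ ℓ ≟L line d i ⟧) + ∑Dir (λ d → multiplicity C d i))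
    ≡⟨ ∑<-distrib-+ n (λ i → ∑Dir (λ d → ⟦ ℓ ≟L line d i ⟧)) (λ i → ∑Dir (λ d → multiplicity C d i)) ⟩
  ∑< n (λ i → ∑Dir (λ d → ⟦ ℓ ≟L line d i ⟧)) + ∑< n (λ i → ∑Dir (λ d → multiplicity C d i))
    ≤⟨ +-mono-≤ (∑<-∑Dir-⟦≟line⟧≤1 ℓ n) (∑<-multiplicity≤length n C) ⟩
  suc (length C) ∎
  where open ≤-Reasoning

fStar*n≤length : ∀ {k f} → IsFStar k 2 f → ∀ n .{{_ : ℕ.NonZero n}} C → IsKCover k n C →
                 f * ℕ→ℚ n ≤ℚ ℕ→ℚ (length C)
fStar*n≤length {k} {f} (_ , minimal) n C cover = begin
  f * ℕ→ℚ n                ≤⟨ ≤*1/⇒*≤ (ℕ→ℚ n) f≤weight ⟩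
  ℕ→ℚ (length (hyps n))    ≤⟨ ℕ→ℚ-mono-≤ hyps≤C ⟩
  ℕ→ℚ (length C)           ∎
  where
  open ℚP.≤-Reasoning
  open Profile k (multiplicity C xConst) (multiplicity C yConst) (multiplicity C sumConst)
  f≤weight : f ≤ℚ ℕ→ℚ (length (hyps n)) * 1/ ℕ→ℚ n
  f≤weight =
    subst (f ≤ℚ_) (trans (totalWeight-uniform _ (hyps n)) (×ℚ≡ℕ→ℚ* (length (hyps n)) (1/ ℕ→ℚ n)))
    (minimal _ (profile-isFractionalCover n λ x y x+y<n →
      ≤-trans (cover x y x+y<n) (coverCount≤∑Dir-multiplicity x y C)))
  hyps≤C : length (hyps n) ≤ length C
  hyps≤C = subst (_≤ length C) (sym (length-hyps n)) (∑<-multiplicity≤length n C)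

theorem2p7 : ∀ (k : ℕ) → 1 ≤ k →
    Σ ℚ λ Ck → ∀ (f : ℚ) → IsFStar k 2 f →
      ∀ (n : ℕ) → 1 ≤ n → ∀ (C : List StdLine) →
        IsKCover k n C → MultMonotone n C →
        (f * ℕ→ℚ n) - Ck ≤ℚ ℕ→ℚ (length C)
theorem2p7 k _ = 0ℚ , λ where
  f fStar (suc n) _ C cover _ →
    subst (_≤ℚ ℕ→ℚ (length C)) (sym (ℚP.+-identityʳ _)) (fStar*n≤length fStar (suc n) C cover)
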